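{- Let $L$ be a coherent frame. Then $L$ is a Heyting frame if and only if the bounded sublattice $K(L)$ of $L$, with the order inherited from $L$, is a Heyting algebra.
   Context: For a frame $L$, an element $a$ is compact if $a\le\bigvee S$ implies $a\le\bigvee T$ for some finite $T\subseteq S$; $K(L)$ denotes the set of compact elements of $L$. A frame $L$ is coherent if every element is a join of compact elements and $K(L)$ is a bounded sublattice of $L$. A frame $L$ is a Heyting frame if $K(L)$ is a Heyting subalgebra of $L$, i.e. $K(L)$ contains $0,1$ and is closed under finite meets, finite joins, and the Heyting implication $\to$ of the frame $L$ (every frame is a complete Heyting algebra). -}

module Defs where

open import Level using (Level; _⊔_; Lift; lift; lower) renaming (suc to lsuc)
open import Data.Nat using (ℕ)
open import Data.Fin using (Fin)
open import Data.Bool using (Bool; true; false)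
open import Data.Empty using (⊥)
open import Data.Product using (Σ; _×_; _,_; proj₁; ∃)
open import Relation.Binary using (Rel; IsPartialOrder)

record Frame (c ℓ₁ ℓ₂ : Level) : Set (lsuc (c ⊔ ℓ₁ ⊔ ℓ₂)) where
  infix  4 _≈_ _≤_
  infixr 7 _∧_
  field
    Carrier        : Set c
    _≈_            : Rel Carrier ℓ₁
    _≤_            : Rel Carrier ℓ₂
    isPartialOrder : IsPartialOrder _≈_ _≤_
    _∧_            : Carrier → Carrier → Carrier
    ⊤              : Carrier
    ⋁              : {I : Set (c ⊔ ℓ₂)} → (I → Carrier) → Carrier
    ∧-lb₁          : ∀ a b → a ∧ b ≤ a
    ∧-lb₂          : ∀ a b → a ∧ b ≤ b
    ∧-glb          : ∀ {x a b} → x ≤ a → x ≤ b → x ≤ a ∧ b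
    ⊤-max          : ∀ a → a ≤ ⊤
    ⋁-ub           : ∀ {I : Set (c ⊔ ℓ₂)} (f : I → Carrier) (i : I) → f i ≤ ⋁ f
    ⋁-lub          : ∀ {I : Set (c ⊔ ℓ₂)} (f : I → Carrier) {x} →
                     (∀ i → f i ≤ x) → ⋁ f ≤ x
    distrib        : ∀ {I : Set (c ⊔ ℓ₂)} (a : Carrier) (f : I → Carrier) →
                     a ∧ ⋁ f ≈ ⋁ (λ i → a ∧ f i)

module FrameNotions {c ℓ₁ ℓ₂} (L : Frame c ℓ₁ ℓ₂) where
  open Frame L

  ⊥L : Carrier
  ⊥L = ⋁ {Lift (c ⊔ ℓ₂) ⊥} (λ ())

  _∨_ : Carrier → Carrier → Carrier
  a ∨ b = ⋁ {Lift (c ⊔ ℓ₂) Bool} (λ { (lift true) → a ; (lift false) → b })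

  _⇒_ : Carrier → Carrier → Carrier
  a ⇒ b = ⋁ {Σ Carrier (λ x → x ∧ a ≤ b)} proj₁

  ⋁fin : ∀ {I : Set (c ⊔ ℓ₂)} (f : I → Carrier) (n : ℕ) (g : Fin n → I) → Carrier
  ⋁fin f n g = ⋁ {Lift (c ⊔ ℓ₂) (Fin n)} (λ k → f (g (lower k)))

  IsCompact : Carrier → Set (lsuc (c ⊔ ℓ₂))
  IsCompact a = ∀ {I : Set (c ⊔ ℓ₂)} (f : I → Carrier) → a ≤ ⋁ f →
                Σ ℕ (λ n → Σ (Fin n → I) (λ g → a ≤ ⋁fin f n g))

  KBoundedSublattice : Set (lsuc (c ⊔ ℓ₂))
  KBoundedSublattice =
    IsCompact ⊥L × IsCompact ⊤ ×
    (∀ a b → IsCompact a → IsCompact b → IsCompact (a ∧ b)) ×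
    (∀ a b → IsCompact a → IsCompact b → IsCompact (a ∨ b))

  IsCoherent : Set (lsuc (c ⊔ ℓ₂) ⊔ ℓ₁)
  IsCoherent =
    (∀ a → Σ (Set (c ⊔ ℓ₂)) (λ I → Σ (I → Carrier) (λ f →
            (∀ i → IsCompact (f i)) × a ≈ ⋁ f))) ×
    KBoundedSublattice

  -- Heyting frame: K(L) is a Heyting subalgebra of L
  IsHeytingFrame : Set (lsuc (c ⊔ ℓ₂))
  IsHeytingFrame =
    KBoundedSublattice ×
    (∀ a b → IsCompact a → IsCompact b → IsCompact (a ⇒ b))

  -- K(L), as a bounded lattice with the order inherited from L (its meet
  -- being the meet of L, as K(L) is a sublattice), is a Heyting algebra:
  -- every pair of compact a, b has a relative pseudocomplement in K(L).
  KIsHeytingAlgebra : Set (lsuc (c ⊔ ℓ₂))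
  KIsHeytingAlgebra =
    ∀ a b → IsCompact a → IsCompact b →
    Σ Carrier (λ r → IsCompact r ×
      (∀ x → IsCompact x → (x ∧ a ≤ b → x ≤ r) × (x ≤ r → x ∧ a ≤ b)))

{-# OPTIONS --safe #-}
module Submission where

-- The Heyting implication a ⇒ b of the frame always satisfies x ≤ a ⇒ b ⟺ x ∧ a ≤ b, so when
-- it is compact it is the relative pseudocomplement in K(L). Conversely, a relative
-- pseudocomplement r of a, b in K(L) lies below a ⇒ b, and every compact x ≤ a ⇒ b lies
-- below r; since a ⇒ b is a join of compact elements, a ⇒ b = r, which is compact.

open import Defs
open import Level using (_⊔_)
open import Data.Product using (_×_; _,_; proj₁; proj₂)
open import Relation.Binary using (IsPartialOrder)

module HeytingFrameProperties {c ℓ₁ ℓ₂} (L : Frame c ℓ₁ ℓ₂) where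
  open Frame L
  open FrameNotions L
  open IsPartialOrder isPartialOrder renaming (trans to ≤-trans; refl to ≤-refl)

  ∧-comm-≤ : ∀ x y → x ∧ y ≤ y ∧ x
  ∧-comm-≤ x y = ∧-glb (∧-lb₂ x y) (∧-lb₁ x y)

  ∧-monoˡ-≤ : ∀ {x y} z → x ≤ y → x ∧ z ≤ y ∧ z
  ∧-monoˡ-≤ z x≤y = ∧-glb (≤-trans (∧-lb₁ _ _) x≤y) (∧-lb₂ _ _)

  ⇒-eval : ∀ a b → (a ⇒ b) ∧ a ≤ b
  ⇒-eval a b = ≤-trans (∧-comm-≤ (a ⇒ b) a)
    (≤-trans (reflexive (distrib a proj₁))
      (⋁-lub _ (λ (x , x∧a≤b) → ≤-trans (∧-comm-≤ a x) x∧a≤b)))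

  ⇒-curry : ∀ {x a b} → x ∧ a ≤ b → x ≤ a ⇒ b
  ⇒-curry {x} x∧a≤b = ⋁-ub proj₁ (x , x∧a≤b)

  ⇒-uncurry : ∀ {x a b} → x ≤ a ⇒ b → x ∧ a ≤ b
  ⇒-uncurry {a = a} {b} x≤a⇒b = ≤-trans (∧-monoˡ-≤ a x≤a⇒b) (⇒-eval a b)

  IsCompact-resp-≤≥ : ∀ {a r} → a ≤ r → r ≤ a → IsCompact r → IsCompact a
  IsCompact-resp-≤≥ a≤r r≤a compact-r f r≤⋁f
    with n , g , r≤⋁fin ← compact-r f (≤-trans r≤a r≤⋁f) =
    n , g , ≤-trans a≤r r≤⋁fin

  ≤-from-compact-below : ∀ {I : Set (c ⊔ ℓ₂)} {f : I → Carrier} {y r} →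
    (∀ i → IsCompact (f i)) → y ≈ ⋁ f →
    (∀ x → IsCompact x → x ≤ y → x ≤ r) → y ≤ r
  ≤-from-compact-below {f = f} compact-f y≈⋁f below =
    ≤-trans (reflexive y≈⋁f)
      (⋁-lub f λ i → below (f i) (compact-f i) (≤-trans (⋁-ub f i) (reflexive (Eq.sym y≈⋁f))))

  ⇒-compact⇒KIsHeytingAlgebra :
    (∀ a b → IsCompact a → IsCompact b → IsCompact (a ⇒ b)) → KIsHeytingAlgebra
  ⇒-compact⇒KIsHeytingAlgebra ⇒-compact a b compact-a compact-b =
    a ⇒ b , ⇒-compact a b compact-a compact-b , λ _ _ → ⇒-curry , ⇒-uncurry

  KIsHeytingAlgebra⇒⇒-compact : IsCoherent → KIsHeytingAlgebra →
    ∀ a b → IsCompact a → IsCompact b → IsCompact (a ⇒ b)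
  KIsHeytingAlgebra⇒⇒-compact (compact-cover , _) heyting a b compact-a compact-b
    with r , compact-r , r-is-rpc ← heyting a b compact-a compact-b
       | _ , _ , compact-f , a⇒b≈⋁f ← compact-cover (a ⇒ b) =
    IsCompact-resp-≤≥ a⇒b≤r r≤a⇒b compact-r
    where
      r≤a⇒b : r ≤ a ⇒ b
      r≤a⇒b = ⇒-curry (proj₂ (r-is-rpc r compact-r) ≤-refl)

      a⇒b≤r : a ⇒ b ≤ r
      a⇒b≤r = ≤-from-compact-below compact-f a⇒b≈⋁f
        λ x compact-x x≤a⇒b → proj₁ (r-is-rpc x compact-x) (⇒-uncurry x≤a⇒b)

theorem3p2 : ∀ {c ℓ₁ ℓ₂} (L : Frame c ℓ₁ ℓ₂) → FrameNotions.IsCoherent L →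
    (FrameNotions.IsHeytingFrame L → FrameNotions.KIsHeytingAlgebra L) ×
    (FrameNotions.KIsHeytingAlgebra L → FrameNotions.IsHeytingFrame L)
theorem3p2 L coherent@(_ , K-sublattice) =
    (λ (_ , ⇒-compact) → ⇒-compact⇒KIsHeytingAlgebra ⇒-compact)
  , (λ heyting → K-sublattice , KIsHeytingAlgebra⇒⇒-compact coherent heyting)
  where open HeytingFrameProperties L
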